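{- Let $s\ge1$, $t\ge 2$, $G\in\mathcal{G}_{s,t}$ with root $r$, and let $C$ be a non-trivial configuration with $k$ pebble-free vertices in $S$. If $C_T\le k$, then Defender has a winning strategy.
   Context: A configuration $C$ on a graph $G$ is a function $C:V(G)\to\mathbb{Z}_{\ge 0}$. A pebbling move removes two pebbles from a vertex and places one pebble on an adjacent vertex. The Two-Player Pebbling Game on $G$ with root $r$ and starting configuration $C$ is played by Mover and Defender in rounds: in each round Mover makes a pebbling move and then Defender makes a pebbling move; each player must take their turn. If Mover pebbles from $u$ to $v$, Defender may not pebble from $v$ to $u$ in the same round. Mover wins if at any time the root has at least one pebble; Defender wins if the root has no pebble and there are no more pebbling moves. A winning strategy is a rule choosing a player's moves as a function of the current position which guarantees that player wins. For integers $s,t\ge1$, $\mathcal{G}_{s,t}$ is the class of all graphs $(K_1\cup \overline{K_t})\vee H$, where $H$ is any graph on $s$ vertices, $\overline{K_t}$ is the edgeless graph on $t$ vertices, $\cup$ is disjoint union and $\vee$ is the join. The root $r$ is the vertex of $K_1$; $S=V(H)$, $T=V(\overline{K_t})$. A configuration is non-trivial if each vertex of $S$ has 0 or 1 pebbles and the root has no pebbles. A vertex is pebble-free if it has no pebbles. $k$ is the number of pebble-free vertices of $S$, and $C_T=\sum_{v\in T}\lfloor C(v)/2\rfloor$. -}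

module Defs where

open import Data.Nat using (ℕ; zero; suc; _+_; _≤_)
open import Data.Nat.DivMod using (_/_)
open import Data.Nat.Properties using (_≟_)
open import Data.Bool using (Bool; true; false)
open import Data.Fin using (Fin)
open import Data.List using (List; length; filter; map; allFin)
open import Data.Nat.ListAction using (sum)
open import Data.Unit using (⊤)
open import Data.Empty using (⊥)
open import Data.Product using (_×_)
open import Relation.Nullary using (¬_)
open import Relation.Binary.PropositionalEquality using (_≡_; _≢_)

record SimpleGraph (s : ℕ) : Set where
  field
    E     : Fin s → Fin s → Bool
    sym   : ∀ i j → E i j ≡ E j i
    loopless : ∀ i → E i i ≡ false
open SimpleGraph public

-- Vertices of (K₁ ∪ K̄_t) ∨ H : the root r, the s vertices of S = V(H),
-- and the t vertices of T = V(K̄_t).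
data Vtx (s t : ℕ) : Set where
  root : Vtx s t
  S    : Fin s → Vtx s t
  T    : Fin t → Vtx s t

Adj : ∀ {s t} → SimpleGraph s → Vtx s t → Vtx s t → Set
Adj H root  (S _) = ⊤
Adj H (S _) root  = ⊤
Adj H (S i) (S j) = E H i j ≡ true
Adj H (S _) (T _) = ⊤
Adj H (T _) (S _) = ⊤
Adj H root  root  = ⊥
Adj H root  (T _) = ⊥
Adj H (T _) root  = ⊥
Adj H (T _) (T _) = ⊥

Config : ℕ → ℕ → Set
Config s t = Vtx s t → ℕ

Step : ∀ {s t} → SimpleGraph s → Config s t → Vtx s t → Vtx s t → Config s t → Set
Step H C u v C' =
  Adj H u v × 2 ≤ C u × C' u + 2 ≡ C u × C' v ≡ suc (C v)
  × (∀ w → w ≢ u → w ≢ v → C' w ≡ C w)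

-- Positions from which Defender can force a win (inductive: all plays are finite).
-- DefWinsM H C     : Mover is to move in configuration C.
-- DefWinsD H C u v : Defender is to move in C, Mover having just pebbled u → v.
-- Mover wins as soon as the root carries a pebble, so every position on a
-- Defender-winning line has an empty root.
mutual
  data DefWinsM {s t} (H : SimpleGraph s) (C : Config s t) : Set where
    moverTurn : C root ≡ 0
              → (∀ u v C' → Step H C u v C' → DefWinsD H C' u v)
              → DefWinsM H C

  data DefWinsD {s t} (H : SimpleGraph s) (C : Config s t) (u v : Vtx s t) : Set where
    noMoves  : C root ≡ 0
             → (∀ x y C' → ¬ Step H C x y C')
             → DefWinsD H C u v
    defMove  : C root ≡ 0
             → ∀ x y C' → Step H C x y C'
             → ¬ (x ≡ v × y ≡ u)
             → DefWinsM H C'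
             → DefWinsD H C u v

DefenderWins : ∀ {s t} → SimpleGraph s → Config s t → Set
DefenderWins H C = DefWinsM H C

NonTrivial : ∀ {s t} → Config s t → Set
NonTrivial {s} C = C root ≡ 0 × (∀ (i : Fin s) → C (S i) ≤ 1)

pebbleFreeS : ∀ {s t} → Config s t → ℕ
pebbleFreeS {s} C = length (filter (λ i → C (S i) ≟ 0) (allFin s))

CT : ∀ {s t} → Config s t → ℕ
CT {s} {t} C = sum (map (λ j → C (T j) / 2) (allFin t))

module Submission where

-- Call a configuration *safe* if the root is empty, every vertex of S holds
-- at most one pebble, and C_T ≤ k.  In a safe configuration the only legal
-- moves go from some T j to some S i.  Defender answers such a move so that
-- the configuration is safe again:
--   * if S i was empty (k and C_T both drop by one), Defender fills another
--     empty vertex of S from T, which exists since C_T ≥ 1 forces k ≥ 1;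
--     if no vertex of T holds two pebbles, no move is possible at all;
--   * if S i held a pebble, it now holds two, and Defender sends one pebble
--     to a vertex of T other than T j (here t ≥ 2 is used): S i becomes
--     empty, so k grows by one while C_T grows by at most one.
-- Every round lowers the number of pebbles on T, which gives termination.

open import Defs hiding (sym)
open import Data.Empty using (⊥-elim)
open import Data.Fin using (Fin; zero; suc; punchIn)
open import Data.Fin.Properties using (punchInᵢ≢i; any?) renaming (_≟_ to _≟ᶠ_)
open import Data.List using (length; filter; tabulate)
open import Data.List.Properties using (map-tabulate)
open import Data.Nat using (ℕ; zero; suc; _+_; _∸_; _≤_; _<_; z≤n; s≤s; _≤?_)
open import Data.Nat.DivMod using (_/_; /-monoˡ-≤; m/n≡1+[m∸n]/n)
open import Data.Nat.Induction using (<-wellFounded)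
open import Data.Nat.ListAction using () renaming (sum to sumList)
open import Data.Nat.Properties
  using (+-0-commutativeMonoid; +-commutativeSemigroup; +-comm; +-assoc; +-suc; +-identityʳ;
         +-cancelʳ-≡; +-cancelʳ-≤; +-monoʳ-≤; ≤-trans; ≤-reflexive;
         m≤m+n; m<m+n; <-trans; n≤1+n; m∸n+n≡m; module ≤-Reasoning)
  renaming (_≟_ to _≟ⁿ_)
open import Data.Product using (_×_; _,_; ∃)
open import Data.Sum using (_⊎_; inj₁; inj₂)
open import Data.Unit using (tt)
open import Function using (id)
open import Induction.WellFounded using (Acc; acc)
open import Relation.Nullary using (¬_; Dec; yes; no)
open import Relation.Nullary.Decidable using (map′)
open import Relation.Binary.PropositionalEquality
  using (_≡_; _≢_; refl; sym; trans; cong; subst; subst₂; module ≡-Reasoning)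

open import Algebra.Properties.CommutativeMonoid.Sum +-0-commutativeMonoid
  using (sum-remove; sum-cong-≗) renaming (sum to ∑)
open import Algebra.Properties.CommutativeSemigroup +-commutativeSemigroup
  using (xy∙z≈zy∙x)

∑-pointUpdate : ∀ {n} {f g : Fin n → ℕ} (a : Fin n) →
                (∀ b → b ≢ a → g b ≡ f b) → ∑ g + f a ≡ ∑ f + g a
∑-pointUpdate {suc n} {f} {g} a same = begin
  ∑ g + f a           ≡⟨ cong (_+ f a) (trans (sum-remove g) (cong (g a +_) restsAgree)) ⟩
  g a + ∑ rest + f a  ≡⟨ xy∙z≈zy∙x (g a) (∑ rest) (f a) ⟩
  f a + ∑ rest + g a  ≡⟨ cong (_+ g a) (sym (sum-remove f)) ⟩
  ∑ f + g a           ∎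
  where
  open ≡-Reasoning
  rest : Fin n → ℕ
  rest k = f (punchIn a k)
  restsAgree : ∑ (λ k → g (punchIn a k)) ≡ ∑ rest
  restsAgree = sum-cong-≗ (λ k → same (punchIn a k) (punchInᵢ≢i a k))

term≤∑ : ∀ {n} (f : Fin n → ℕ) (a : Fin n) → f a ≤ ∑ f
term≤∑ {suc n} f a = subst (f a ≤_) (sym (sum-remove f)) (m≤m+n _ _)

∑-positive : ∀ {n} (f : Fin n → ℕ) → 1 ≤ ∑ f → ∃ λ a → 1 ≤ f a
∑-positive {suc n} f pos with f zero in eq
... | suc _ = zero , subst (1 ≤_) (sym eq) (s≤s z≤n)
... | zero with ∑-positive (λ k → f (suc k)) pos
...   | a , fa≥1 = suc a , fa≥1

sumList-tabulate : ∀ {n} (f : Fin n → ℕ) → sumList (tabulate f) ≡ ∑ f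
sumList-tabulate {zero} f = refl
sumList-tabulate {suc n} f = cong (f zero +_) (sumList-tabulate (λ k → f (suc k)))

isZero : ℕ → ℕ
isZero zero = 1
isZero (suc _) = 0

length-filter-zero : ∀ {A : Set} {n} (g : Fin n → A) (f : A → ℕ) →
  length (filter (λ x → f x ≟ⁿ 0) (tabulate g)) ≡ ∑ (λ k → isZero (f (g k)))
length-filter-zero {n = zero} g f = refl
length-filter-zero {n = suc n} g f with f (g zero)
... | zero = cong suc (length-filter-zero (λ k → g (suc k)) f)
... | suc _ = length-filter-zero (λ k → g (suc k)) f

half-2+ : ∀ x → (2 + x) / 2 ≡ suc (x / 2)
half-2+ x = m/n≡1+[m∸n]/n {2 + x} {2} (s≤s (s≤s z≤n))

half-suc : ∀ x → suc x / 2 ≤ suc (x / 2)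
half-suc x = ≤-trans (/-monoˡ-≤ 2 (n≤1+n (suc x))) (≤-reflexive (half-2+ x))

cancel-shift : ∀ {x y b} d → x + (b + d) ≡ y + b → x + d ≡ y
cancel-shift {x} {y} {b} d eq = +-cancelʳ-≡ b _ _ (begin
  x + d + b    ≡⟨ +-assoc x d b ⟩
  x + (d + b)  ≡⟨ cong (x +_) (+-comm d b) ⟩
  x + (b + d)  ≡⟨ eq ⟩
  y + b        ∎)
  where open ≡-Reasoning

cancel-grow : ∀ {x y a} d → x + a ≡ y + (a + d) → x ≡ y + d
cancel-grow {x} {y} {a} d eq = +-cancelʳ-≡ a _ _ (begin
  x + a        ≡⟨ eq ⟩
  y + (a + d)  ≡⟨ cong (y +_) (+-comm a d) ⟩
  y + (d + a)  ≡⟨ sym (+-assoc y d a) ⟩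
  y + d + a    ∎)
  where open ≡-Reasoning

module _ {s t : ℕ} where

  _≟ᵛ_ : (x y : Vtx s t) → Dec (x ≡ y)
  root ≟ᵛ root = yes refl
  root ≟ᵛ S _  = no (λ ())
  root ≟ᵛ T _  = no (λ ())
  S _  ≟ᵛ root = no (λ ())
  S a  ≟ᵛ S b  = map′ (cong S) (λ { refl → refl }) (a ≟ᶠ b)
  S _  ≟ᵛ T _  = no (λ ())
  T _  ≟ᵛ root = no (λ ())
  T _  ≟ᵛ S _  = no (λ ())
  T a  ≟ᵛ T b  = map′ (cong T) (λ { refl → refl }) (a ≟ᶠ b)

  update : Config s t → Vtx s t → ℕ → Config s t
  update C u n w with w ≟ᵛ u
  ... | yes _ = n
  ... | no _  = C w

  update-here : ∀ C u n → update C u n u ≡ n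
  update-here C u n with u ≟ᵛ u
  ... | yes _  = refl
  ... | no u≢u = ⊥-elim (u≢u refl)

  update-there : ∀ C u n {w} → w ≢ u → update C u n w ≡ C w
  update-there C u n {w} w≢u with w ≟ᵛ u
  ... | yes w≡u = ⊥-elim (w≢u w≡u)
  ... | no _    = refl

  move : Config s t → Vtx s t → Vtx s t → Config s t
  move C u v = update (update C u (C u ∸ 2)) v (suc (C v))

  move-step : ∀ (H : SimpleGraph s) C {u v} → Adj H u v → u ≢ v → 2 ≤ C u →
              Step H C u v (move C u v)
  move-step H C {u} {v} adj u≢v 2≤Cu =
    adj , 2≤Cu , source , update-here _ v _ , others
    where
    source : move C u v u + 2 ≡ C u
    source = trans (cong (_+ 2) (trans (update-there _ v _ u≢v) (update-here C u _)))
                   (m∸n+n≡m 2≤Cu)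
    others : ∀ w → w ≢ u → w ≢ v → move C u v w ≡ C w
    others w w≢u w≢v = trans (update-there _ v _ w≢v) (update-there C u _ w≢u)

module _ {s t : ℕ} where

  sWeight : (ℕ → ℕ) → Config s t → ℕ
  sWeight h C = ∑ (λ i → h (C (S i)))

  tWeight : (ℕ → ℕ) → Config s t → ℕ
  tWeight h C = ∑ (λ j → h (C (T j)))

  tPebbles : Config s t → ℕ
  tPebbles = tWeight id

  pairsOnT : Config s t → ℕ
  pairsOnT = tWeight (_/ 2)

  pebbleFree : Config s t → ℕ
  pebbleFree = sWeight isZero

  CT≡pairsOnT : ∀ C → CT C ≡ pairsOnT C
  CT≡pairsOnT C = trans (cong sumList (map-tabulate id (λ j → C (T j) / 2)))
                        (sumList-tabulate (λ j → C (T j) / 2))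

  pebbleFreeS≡pebbleFree : ∀ C → pebbleFreeS C ≡ pebbleFree C
  pebbleFreeS≡pebbleFree C = length-filter-zero id (λ i → C (S i))

  Frame : Config s t → Config s t → Fin s → Fin t → Set
  Frame C C' i j = ∀ w → w ≢ S i → w ≢ T j → C' w ≡ C w

  frame-root : ∀ {C C' i j} → Frame C C' i j → C' root ≡ C root
  frame-root frame = frame root (λ ()) (λ ())

  frame-S : ∀ {C C' i j} → Frame C C' i j → ∀ b → b ≢ i → C' (S b) ≡ C (S b)
  frame-S frame b b≢i = frame (S b) (λ { refl → b≢i refl }) (λ ())

  sWeight-frame : ∀ h {C C' i j} → Frame C C' i j →
                  sWeight h C' + h (C (S i)) ≡ sWeight h C + h (C' (S i))
  sWeight-frame h {i = i} frame =
    ∑-pointUpdate i (λ b b≢i → cong h (frame-S frame b b≢i))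

  tWeight-frame : ∀ h {C C' i j} → Frame C C' i j →
                  tWeight h C' + h (C (T j)) ≡ tWeight h C + h (C' (T j))
  tWeight-frame h {j = j} frame =
    ∑-pointUpdate j (λ b b≢j → cong h (frame (T b) (λ ()) (λ { refl → b≢j refl })))

  free-change : ∀ {C C' i j x x'} → Frame C C' i j → C (S i) ≡ x → C' (S i) ≡ x' →
                pebbleFree C' + isZero x ≡ pebbleFree C + isZero x'
  free-change frame refl refl = sWeight-frame isZero frame

anotherT : ∀ {t} → 2 ≤ t → (j : Fin t) → ∃ λ j' → j' ≢ j
anotherT (s≤s (s≤s _)) j = punchIn j zero , punchInᵢ≢i j zero

2≰1 : ¬ 2 ≤ 1
2≰1 (s≤s ())

atMostOne-cases : ∀ {x} → x ≤ 1 → x ≡ 0 ⊎ x ≡ 1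
atMostOne-cases {zero} _ = inj₁ refl
atMostOne-cases {suc zero} _ = inj₂ refl
atMostOne-cases {suc (suc _)} (s≤s ())

isZero-positive : ∀ {x} → 1 ≤ isZero x → x ≡ 0
isZero-positive {zero} _ = refl

drop-two : ∀ {x y} → x + 2 ≡ y → x < y
drop-two {x} eq = subst (x <_) eq (m<m+n x (s≤s z≤n))

drop-then-add : ∀ {x y z} → x + 2 ≡ y → z ≡ suc x → z < y
drop-then-add {x} drop add =
  subst₂ _<_ (sym add) drop (≤-reflexive (+-comm 2 x))

module Strategy {s t : ℕ} (H : SimpleGraph s) where

  record Safe (C : Config s t) : Set where
    field
      rootEmpty  : C root ≡ 0
      sAtMostOne : ∀ i → C (S i) ≤ 1
      budget     : pairsOnT C ≤ pebbleFree C
  open Safe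

  module _ {C C' : Config s t} {j : Fin t} {i : Fin s} where

    module FromT (step : Step H C (T j) (S i) C') where

      frame : Frame C C' i j
      frame w w≢Si w≢Tj = let (_ , _ , _ , _ , others) = step in others w w≢Tj w≢Si

      source : C' (T j) + 2 ≡ C (T j)
      source = let (_ , _ , eq , _) = step in eq

      target : C' (S i) ≡ suc (C (S i))
      target = let (_ , _ , _ , eq , _) = step in eq

      tPebbles-drop : tPebbles C' + 2 ≡ tPebbles C
      tPebbles-drop = cancel-shift 2
        (subst (λ x → tPebbles C' + x ≡ tPebbles C + C' (T j)) (sym source)
               (tWeight-frame id frame))

      pairs-drop : pairsOnT C' + 1 ≡ pairsOnT C
      pairs-drop = cancel-shift 1
        (subst (λ x → pairsOnT C' + x ≡ pairsOnT C + C' (T j) / 2)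
               (trans (cong (_/ 2) (trans (sym source) (+-comm _ 2)))
                      (trans (half-2+ (C' (T j))) (+-comm 1 _)))
               (tWeight-frame (_/ 2) frame))

      free-drop : C (S i) ≡ 0 → pebbleFree C' + 1 ≡ pebbleFree C
      free-drop empty =
        trans (free-change frame empty (trans target (cong suc empty))) (+-identityʳ _)

      free-same : C (S i) ≡ 1 → pebbleFree C' ≡ pebbleFree C
      free-same one = +-cancelʳ-≡ 0 _ _ (free-change frame one (trans target (cong suc one)))

    module FromS (step : Step H C (S i) (T j) C') where

      frame : Frame C C' i j
      frame = let (_ , _ , _ , _ , others) = step in others

      source : C' (S i) + 2 ≡ C (S i)
      source = let (_ , _ , eq , _) = step in eq

      target : C' (T j) ≡ suc (C (T j))
      target = let (_ , _ , _ , eq , _) = step in eq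

      tPebbles-grow : tPebbles C' ≡ suc (tPebbles C)
      tPebbles-grow = trans (cancel-grow 1 (trans (tWeight-frame id frame)
                                           (cong (tPebbles C +_) (trans target (+-comm 1 _)))))
                            (+-comm _ 1)

      pairs-grow : pairsOnT C' ≤ suc (pairsOnT C)
      pairs-grow = +-cancelʳ-≤ (C (T j) / 2) _ _ (begin
        pairsOnT C' + C (T j) / 2    ≡⟨ tWeight-frame (_/ 2) frame ⟩
        pairsOnT C + C' (T j) / 2    ≡⟨ cong (λ x → pairsOnT C + x / 2) target ⟩
        pairsOnT C + suc (C (T j)) / 2
                                     ≤⟨ +-monoʳ-≤ (pairsOnT C) (half-suc (C (T j))) ⟩
        pairsOnT C + suc (C (T j) / 2)
                                     ≡⟨ +-suc _ _ ⟩
        suc (pairsOnT C) + C (T j) / 2 ∎)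
        where open ≤-Reasoning

      emptied : C (S i) ≡ 2 → C' (S i) ≡ 0
      emptied two = +-cancelʳ-≡ 2 _ 0 (trans source two)

      free-grow : C (S i) ≡ 2 → pebbleFree C' ≡ suc (pebbleFree C)
      free-grow two = trans (sym (+-identityʳ _))
        (trans (free-change frame two (emptied two)) (+-comm _ 1))

  data FromTToS : Vtx s t → Vtx s t → Set where
    fromTToS : ∀ j i → FromTToS (T j) (S i)

  safe-moves : ∀ {C C' u v} → Safe C → Step H C u v C' → FromTToS u v
  safe-moves {u = root} safe (_ , 2≤C , _) =
    ⊥-elim (2≰1 (≤-trans 2≤C (≤-trans (≤-reflexive (rootEmpty safe)) z≤n)))
  safe-moves {u = S i} safe (_ , 2≤C , _) = ⊥-elim (2≰1 (≤-trans 2≤C (sAtMostOne safe i)))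
  safe-moves {u = T j} {root} _ (() , _)
  safe-moves {u = T j} {S i} _ _ = fromTToS j i
  safe-moves {u = T j} {T _} _ (() , _)

  stuck : ∀ {C} → Safe C → ¬ (∃ λ j → 2 ≤ C (T j)) → ∀ x y C' → ¬ Step H C x y C'
  stuck safe none x y C' step with safe-moves safe step
  ... | fromTToS j i = let (_ , 2≤C , _) = step in none (j , 2≤C)

  -- A vertex of T with two pebbles gives C_T ≥ 1, hence k ≥ 1.
  emptyVertex : ∀ {C j} → Safe C → 2 ≤ C (T j) → ∃ λ i → C (S i) ≡ 0
  emptyVertex {C} {j} safe 2≤C
    with ∑-positive (λ i → isZero (C (S i))) (≤-trans pairsPositive (budget safe))
    where
    pairsPositive : 1 ≤ pairsOnT C
    pairsPositive = ≤-trans (/-monoˡ-≤ 2 2≤C) (term≤∑ (λ b → C (T b) / 2) j)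
  ... | i , positive = i , isZero-positive positive

  fill-safe : ∀ {C C' j i} → Safe C → C (S i) ≡ 0 → Step H C (T j) (S i) C' → Safe C'
  fill-safe {C} {C'} {j} {i} safe empty step = record
    { rootEmpty  = trans (frame-root frame) (rootEmpty safe)
    ; sAtMostOne = atMostOne
    ; budget     = +-cancelʳ-≤ 1 _ _
                     (subst₂ _≤_ (sym pairs-drop) (sym (free-drop empty)) (budget safe))
    }
    where
    open FromT {C} {C'} {j} {i} step
    atMostOne : ∀ b → C' (S b) ≤ 1
    atMostOne b with b ≟ᶠ i
    ... | yes refl = ≤-reflexive (trans target (cong suc empty))
    ... | no b≢i  = subst (_≤ 1) (sym (frame-S frame b b≢i)) (sAtMostOne safe b)

  -- Mover adds a second pebble to S i and Defender moves one of them to T: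
  -- S i becomes empty, so k grows by one while C_T grows by at most one.
  bounce-safe : ∀ {C C' C'' j j' i} → Safe C → C (S i) ≡ 1 →
                Step H C (T j) (S i) C' → Step H C' (S i) (T j') C'' → Safe C''
  bounce-safe {C} {C'} {C''} {j} {j'} {i} safe one fill bounce = record
    { rootEmpty  = trans (frame-root B.frame) (trans (frame-root F.frame) (rootEmpty safe))
    ; sAtMostOne = atMostOne
    ; budget     = budget''
    }
    where
    module F = FromT {C} {C'} {j} {i} fill
    module B = FromS {C'} {C''} {j'} {i} bounce
    two : C' (S i) ≡ 2
    two = trans F.target (cong suc one)
    atMostOne : ∀ b → C'' (S b) ≤ 1
    atMostOne b with b ≟ᶠ i
    ... | yes refl = ≤-trans (≤-reflexive (B.emptied two)) z≤n
    ... | no b≢i  = subst (_≤ 1) (sym (trans (frame-S B.frame b b≢i) (frame-S F.frame b b≢i)))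
                          (sAtMostOne safe b)
    budget'' : pairsOnT C'' ≤ pebbleFree C''
    budget'' = begin
      pairsOnT C''           ≤⟨ B.pairs-grow ⟩
      suc (pairsOnT C')      ≡⟨ trans (+-comm 1 _) F.pairs-drop ⟩
      pairsOnT C             ≤⟨ budget safe ⟩
      pebbleFree C           ≡⟨ sym (F.free-same one) ⟩
      pebbleFree C'          ≤⟨ n≤1+n _ ⟩
      suc (pebbleFree C')    ≡⟨ sym (B.free-grow two) ⟩
      pebbleFree C''         ∎
      where open ≤-Reasoning

  WinsBelow : ℕ → Set
  WinsBelow n = ∀ C → tPebbles C < n → Safe C → DefWinsM H C

  fillOrPass : ∀ {C j v} → WinsBelow (tPebbles C) → Safe C → DefWinsD H C (T j) v
  fillOrPass {C} wins safe with any? (λ j' → 2 ≤? C (T j'))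
  ... | no none = noMoves (rootEmpty safe) (stuck safe none)
  ... | yes (j' , 2≤C) with emptyVertex safe 2≤C
  ...   | i' , empty =
    defMove (rootEmpty safe) (T j') (S i') C' step (λ { (_ , ()) })
            (wins C' (drop-two Fill.tPebbles-drop) (fill-safe safe empty step))
    where
    C' = move C (T j') (S i')
    step : Step H C (T j') (S i') C'
    step = move-step H C tt (λ ()) 2≤C
    module Fill = FromT {C} {C'} {j'} {i'} step

  fillReply : ∀ {C C' j i} → WinsBelow (tPebbles C) → Safe C → C (S i) ≡ 0 →
              Step H C (T j) (S i) C' → DefWinsD H C' (T j) (S i)
  fillReply {C} {C'} {j} {i} wins safe empty step =
    fillOrPass (λ C'' fewer → wins C'' (<-trans fewer (drop-two Mover.tPebbles-drop)))
               (fill-safe safe empty step)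
    where module Mover = FromT {C} {C'} {j} {i} step

  bounceReply : ∀ {C C' j i} → 2 ≤ t → WinsBelow (tPebbles C) → Safe C → C (S i) ≡ 1 →
                Step H C (T j) (S i) C' → DefWinsD H C' (T j) (S i)
  bounceReply {C} {C'} {j} {i} t≥2 wins safe one step with anotherT t≥2 j
  ... | j' , j'≢j =
    defMove rootEmpty' (S i) (T j') C'' step' notReverse
            (wins C'' fewer (bounce-safe safe one step step'))
    where
    module Mover = FromT {C} {C'} {j} {i} step
    rootEmpty' : C' root ≡ 0
    rootEmpty' = trans (frame-root Mover.frame) (rootEmpty safe)
    C'' = move C' (S i) (T j')
    step' : Step H C' (S i) (T j') C''
    step' = move-step H C' tt (λ ()) (≤-reflexive (sym (trans Mover.target (cong suc one))))
    notReverse : ¬ (S i ≡ S i × T j' ≡ T j)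
    notReverse (_ , refl) = j'≢j refl
    fewer : tPebbles C'' < tPebbles C
    fewer = drop-then-add Mover.tPebbles-drop (FromS.tPebbles-grow {C'} {C''} {j'} {i} step')

  defenderWins : 2 ≤ t → ∀ C → Acc _<_ (tPebbles C) → Safe C → DefWinsM H C
  defenderWins t≥2 C (acc smaller) safe = moverTurn (rootEmpty safe) reply
    where
    wins : WinsBelow (tPebbles C)
    wins C' fewer = defenderWins t≥2 C' (smaller fewer)
    reply : ∀ u v C' → Step H C u v C' → DefWinsD H C' u v
    reply u v C' step with safe-moves safe step
    ... | fromTToS j i with atMostOne-cases (sAtMostOne safe i)
    ...   | inj₁ empty = fillReply wins safe empty step
    ...   | inj₂ one   = bounceReply t≥2 wins safe one step

open Strategy using (defenderWins)

lemma3p5 : (s t : ℕ) → 1 ≤ s → 2 ≤ t → (H : SimpleGraph s) → (C : Config s t)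
         → NonTrivial C → CT C ≤ pebbleFreeS C → DefenderWins H C
lemma3p5 s t _ t≥2 H C (rootEmpty , sAtMostOne) CT≤k =
  defenderWins H t≥2 C (<-wellFounded _) record
    { rootEmpty  = rootEmpty
    ; sAtMostOne = sAtMostOne
    ; budget     = subst₂ _≤_ (CT≡pairsOnT C) (pebbleFreeS≡pebbleFree C) CT≤k
    }
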